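{- Let $G$ be a graph on $t > 1000$ vertices, with edge weights as defined below. For $i \in \{2, 3\}$, let $e_i$ be the number of edges of weight $i$ and let $\bar{e}$ be the number of edges of the complement $\bar{G}$ of $G$. If $\bar{e} \le t^2/4$, then $w(G) = 2^{e_2}3^{e_3} \le 2^{\binom{t}{2}}2^{ -0.16\bar{e}}$. If $\bar{e} > t^2/4$, then $w(G) < 3^{t^2/4}$ (and $3^{t^2/4}$ is much smaller than $2^{\binom{t}{2}}$).
   Context: Given a graph $G$, each edge of $G$ gets weight $2$ if it belongs to some triangle of $G$ and weight $3$ otherwise; $w(G)$ is the product of the weights of all edges of $G$. -}

module Defs where

open import Data.Nat using (ℕ; _<?_)
open import Data.Bool using (Bool; true; false; _∧_; not; if_then_else_; T)
open import Data.Bool.Properties using (T?)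
open import Data.Fin using (Fin; toℕ)
open import Data.List using (List; allFin; concatMap; map; filter; length)
open import Data.Bool.ListAction using (any)
open import Data.Nat.ListAction using (product)
open import Data.Product using (_×_; _,_; proj₁; proj₂)
open import Relation.Binary.PropositionalEquality using (_≡_)

record Graph (t : ℕ) : Set where
  field
    adj    : Fin t → Fin t → Bool
    sym    : ∀ i j → adj i j ≡ adj j i
    irrefl : ∀ i → adj i i ≡ false
open Graph public

-- All unordered pairs {i , j}, represented as (i , j) with i < j.
pairs : (t : ℕ) → List (Fin t × Fin t)
pairs t = filter (λ p → toℕ (proj₁ p) <? toℕ (proj₂ p))
                 (concatMap (λ i → map (λ j → i , j) (allFin t)) (allFin t))

edges : ∀ {t} → Graph t → List (Fin t × Fin t)
edges {t} G = filter (λ p → T? (adj G (proj₁ p) (proj₂ p))) (pairs t)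

nonEdges : ∀ {t} → Graph t → List (Fin t × Fin t)
nonEdges {t} G = filter (λ p → T? (not (adj G (proj₁ p) (proj₂ p)))) (pairs t)

inTriangle : ∀ {t} → Graph t → Fin t × Fin t → Bool
inTriangle {t} G (i , j) = any (λ k → adj G i k ∧ adj G j k) (allFin t)

weight : ∀ {t} → Graph t → Fin t × Fin t → ℕ
weight G e = if inTriangle G e then 2 else 3

w : ∀ {t} → Graph t → ℕ
w G = product (map (weight G) (edges G))

e₂ : ∀ {t} → Graph t → ℕ
e₂ G = length (filter (λ e → T? (inTriangle G e)) (edges G))

e₃ : ∀ {t} → Graph t → ℕ
e₃ G = length (filter (λ e → T? (not (inTriangle G e))) (edges G))

ē : ∀ {t} → Graph t → ℕ
ē G = length (nonEdges G)

-- A weight-3 edge ij has no common neighbour, so every vertex is a non-neighbour of i or of j: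
-- nonDeg i + nonDeg j ≥ t. Weighting by deg₃ u, the number of weight-3 edges at u, this gives
-- t · Σ deg₃ ≤ 2 Σ deg₃ · nonDeg. Conversely deg₃ u + nonDeg u ≤ t, so AM–GM bounds
-- deg₃ u · nonDeg u vertex by vertex. With Σ deg₃ = 2 e₃ and Σ nonDeg = 2 ē + t the two estimates
-- combine to (t − 3) e₃ ≤ (t − 1) ē, hence 5 e₃ ≤ 7 ē once t ≥ 8. As log₂ 3 < 8/5, this gives
-- log₂ w ≤ e₂ + e₃ + (3/5) e₃ ≤ C(t,2) − ē + (21/25) ē, the sparse bound. The dense bound only
-- needs w ≤ 3^(e₂+e₃) and e₂ + e₃ = C(t,2) − ē < t²/4.

module Submission where

open import Defs
open import Data.Nat using (ℕ; _+_; _*_; _^_; _≤_; _<_)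
open import Data.Nat.Combinatorics using (_C_)
open import Data.Product using (_×_)
open import Relation.Binary.PropositionalEquality using (_≡_)

open import Data.Nat.Properties
open import Algebra.Properties.CommutativeSemigroup *-commutativeSemigroup using (x∙yz≈y∙xz)
open import Algebra.Properties.Semiring.Sum +-*-semiring
  using (sum; sum-syntax; ∑-distrib-+; ∑-comm; *-distribˡ-sum; *-distribʳ-sum; sum-cong-≗)
open import Data.Bool using (Bool; true; false; _∧_; not; if_then_else_; T)
open import Data.Bool.ListAction using (or)
open import Data.Bool.Properties using (T?; ∧-comm)
open import Data.Empty using (⊥-elim)
open import Data.Fin using (Fin; toℕ; zero; suc)
open import Data.List using (List; []; _∷_; _++_; map; filter; filterᵇ; length; concatMap; tabulate; allFin)
open import Data.List.Membership.Propositional using (lose)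
open import Data.List.Membership.Propositional.Properties using (∈-allFin)
open import Data.List.Properties using (map-++; map-∘; map-cong)
open import Data.List.Relation.Unary.Any.Properties using (any⁺)
open import Data.Nat using (zero; suc; z≤n; s≤s; _<ᵇ_)
open import Data.Nat.Combinatorics using (nC1≡n; nCk+nC[k+1]≡[n+1]C[k+1])
import Data.Nat.ListAction as List
open import Data.Nat.ListAction using (product)
open import Data.Nat.ListAction.Properties using (sum-++)
open import Data.Nat.Solver using (module +-*-Solver)
open import Data.Product using (_,_; proj₁; proj₂)
open import Data.Sum using ([_,_]′)
open import Function using (_∘_)
import Relation.Binary.PropositionalEquality as ≡
open ≡ using (refl; trans; cong; cong₂; module ≡-Reasoning)
open import Relation.Nullary using (does; ¬_)
open import Relation.Nullary.Decidable using (toWitness)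
open import Relation.Unary using (Pred; Decidable)

open +-*-Solver

-- Iverson brackets and sums over Fin

𝟙 : Bool → ℕ
𝟙 true  = 1
𝟙 false = 0

[_<_] : ∀ {n} → Fin n → Fin n → ℕ
[ i < j ] = 𝟙 (toℕ i <ᵇ toℕ j)

𝟙-∧ : ∀ a b → 𝟙 (a ∧ b) ≡ 𝟙 a * 𝟙 b
𝟙-∧ true  b = ≡.sym (+-identityʳ (𝟙 b))
𝟙-∧ false b = refl

∑-const : ∀ n c → ∑[ i < n ] c ≡ n * c
∑-const zero    c = refl
∑-const (suc n) c = cong (c +_) (∑-const n c)

∑-mono-≤ : ∀ {n} {f g : Fin n → ℕ} → (∀ i → f i ≤ g i) → sum f ≤ sum g
∑-mono-≤ {zero}  f≤g = z≤n
∑-mono-≤ {suc n} f≤g = +-mono-≤ (f≤g zero) (∑-mono-≤ (f≤g ∘ suc))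

term≤∑ : ∀ {n} (f : Fin n → ℕ) i → f i ≤ sum f
term≤∑ f zero    = m≤m+n _ _
term≤∑ f (suc i) = ≤-trans (term≤∑ (f ∘ suc) i) (m≤n+m _ _)

∑∑-lower-triangle : ∀ n → ∑[ i < n ] ∑[ j < n ] [ i < j ] ≡ n C 2
∑∑-lower-triangle zero    = refl
∑∑-lower-triangle (suc n) = begin
  ∑[ j < n ] 1 + ∑[ i < n ] ∑[ j < n ] [ i < j ]  ≡⟨ cong₂ _+_ (trans (∑-const n 1) (*-identityʳ n)) (∑∑-lower-triangle n) ⟩
  n + n C 2                                        ≡⟨ cong (_+ n C 2) (nC1≡n n) ⟨
  n C 1 + n C 2                                    ≡⟨ nCk+nC[k+1]≡[n+1]C[k+1] n 1 ⟩
  suc n C 2                                        ∎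
  where open ≡-Reasoning

∑∑-symmetric : ∀ {n} (f : Fin n → Fin n → ℕ) → (∀ i j → f i j ≡ f j i) →
  ∑[ i < n ] ∑[ j < n ] f i j ≡ 2 * ∑[ i < n ] ∑[ j < n ] ([ i < j ] * f i j) + ∑[ i < n ] f i i
∑∑-symmetric {zero}  f f-sym = refl
∑∑-symmetric {suc n} f f-sym = begin
  (f₀₀ + R) + ∑[ i < n ] (f (suc i) zero + ∑[ j < n ] g i j)
    ≡⟨ cong ((f₀₀ + R) +_) (∑-distrib-+ (λ i → f (suc i) zero) (λ i → ∑[ j < n ] g i j)) ⟩
  (f₀₀ + R) + (∑[ i < n ] f (suc i) zero + ∑[ i < n ] ∑[ j < n ] g i j)
    ≡⟨ cong ((f₀₀ + R) +_) (cong₂ _+_ (sum-cong-≗ (λ i → f-sym (suc i) zero))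
                                        (∑∑-symmetric g (λ i j → f-sym (suc i) (suc j)))) ⟩
  (f₀₀ + R) + (R + (2 * S + D))
    ≡⟨ solve 4 (λ f₀₀ R S D → (f₀₀ :+ R) :+ (R :+ (con 2 :* S :+ D))
                            := con 2 :* (R :+ S) :+ (f₀₀ :+ D)) refl f₀₀ R S D ⟩
  2 * (R + S) + (f₀₀ + D)
    ≡⟨ cong (λ x → 2 * (x + S) + (f₀₀ + D)) (sum-cong-≗ (λ j → ≡.sym (*-identityˡ (f zero (suc j))))) ⟩
  2 * (∑[ j < n ] (1 * f zero (suc j)) + S) + (f₀₀ + D)  ∎
  where
  open ≡-Reasoning
  f₀₀ = f zero zero
  g : Fin n → Fin n → ℕ
  g i j = f (suc i) (suc j)
  R = ∑[ j < n ] f zero (suc j)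
  S = ∑[ i < n ] ∑[ j < n ] ([ i < j ] * g i j)
  D = ∑[ i < n ] g i i

-- Counting along lists

module _ {a p} {A : Set a} {P : Pred A p} (P? : Decidable P) where

  length-filter : ∀ xs → length (filter P? xs) ≡ List.sum (map (𝟙 ∘ does ∘ P?) xs)
  length-filter []       = refl
  length-filter (x ∷ xs) with does (P? x)
  ... | true  = cong suc (length-filter xs)
  ... | false = length-filter xs

  sum-map-filter : ∀ (f : A → ℕ) xs →
    List.sum (map f (filter P? xs)) ≡ List.sum (map (λ x → 𝟙 (does (P? x)) * f x) xs)
  sum-map-filter f []       = refl
  sum-map-filter f (x ∷ xs) with does (P? x)
  ... | true  = cong₂ _+_ (≡.sym (+-identityʳ (f x))) (sum-map-filter f xs)
  ... | false = sum-map-filter f xs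

sum-map-tabulate : ∀ {a} {A : Set a} {n} (f : A → ℕ) (g : Fin n → A) →
  List.sum (map f (tabulate g)) ≡ ∑[ i < n ] f (g i)
sum-map-tabulate {n = zero}  f g = refl
sum-map-tabulate {n = suc n} f g = cong (f (g zero) +_) (sum-map-tabulate f (g ∘ suc))

sum-map-concatMap : ∀ {a b} {A : Set a} {B : Set b} (f : B → ℕ) (g : A → List B) xs →
  List.sum (map f (concatMap g xs)) ≡ List.sum (map (List.sum ∘ map f ∘ g) xs)
sum-map-concatMap f g []       = refl
sum-map-concatMap f g (x ∷ xs) = begin
  List.sum (map f (g x ++ concatMap g xs))
    ≡⟨ cong List.sum (map-++ f (g x) (concatMap g xs)) ⟩
  List.sum (map f (g x) ++ map f (concatMap g xs))
    ≡⟨ sum-++ (map f (g x)) (map f (concatMap g xs)) ⟩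
  List.sum (map f (g x)) + List.sum (map f (concatMap g xs))
    ≡⟨ cong (List.sum (map f (g x)) +_) (sum-map-concatMap f g xs) ⟩
  List.sum (map f (g x)) + List.sum (map (List.sum ∘ map f ∘ g) xs)  ∎
  where open ≡-Reasoning

allPairs : ∀ t → List (Fin t × Fin t)
allPairs t = concatMap (λ i → map (i ,_) (allFin t)) (allFin t)

sum-map-allPairs : ∀ {t} (f : Fin t × Fin t → ℕ) →
  List.sum (map f (allPairs t)) ≡ ∑[ i < t ] ∑[ j < t ] f (i , j)
sum-map-allPairs {t} f = begin
  List.sum (map f (allPairs t))
    ≡⟨ sum-map-concatMap f (λ i → map (i ,_) (allFin t)) (allFin t) ⟩
  List.sum (map (λ i → List.sum (map f (map (i ,_) (allFin t)))) (allFin t))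
    ≡⟨ sum-map-tabulate (λ i → List.sum (map f (map (i ,_) (allFin t)))) (λ i → i) ⟩
  ∑[ i < t ] List.sum (map f (map (i ,_) (allFin t)))
    ≡⟨ sum-cong-≗ {t} (λ i → cong List.sum (map-∘ {g = f} {f = i ,_} (allFin t))) ⟨
  ∑[ i < t ] List.sum (map (λ j → f (i , j)) (allFin t))
    ≡⟨ sum-cong-≗ (λ i → sum-map-tabulate (λ j → f (i , j)) (λ j → j)) ⟩
  ∑[ i < t ] ∑[ j < t ] f (i , j)  ∎
  where open ≡-Reasoning

sum-map-pairs : ∀ {t} (f : Fin t × Fin t → ℕ) →
  List.sum (map f (pairs t)) ≡ ∑[ i < t ] ∑[ j < t ] ([ i < j ] * f (i , j))
sum-map-pairs {t} f =
  trans (sum-map-filter (λ p → toℕ (proj₁ p) <? toℕ (proj₂ p)) f (allPairs t)) (sum-map-allPairs {t} _)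

length-pairs : ∀ t → length (pairs t) ≡ t C 2
length-pairs t = begin
  length (pairs t)
    ≡⟨ length-filter (λ p → toℕ (proj₁ p) <? toℕ (proj₂ p)) (allPairs t) ⟩
  List.sum (map (λ p → 𝟙 (toℕ (proj₁ p) <ᵇ toℕ (proj₂ p))) (allPairs t))
    ≡⟨ sum-map-allPairs {t} _ ⟩
  ∑[ i < t ] ∑[ j < t ] [ i < j ]
    ≡⟨ ∑∑-lower-triangle t ⟩
  t C 2  ∎
  where open ≡-Reasoning

module _ {a} {A : Set a} (p : A → Bool) where

  length-filterᵇ-partition : ∀ xs → length (filterᵇ p xs) + length (filterᵇ (not ∘ p) xs) ≡ length xs
  length-filterᵇ-partition []       = refl
  length-filterᵇ-partition (x ∷ xs) with p x
  ... | true  = cong suc (length-filterᵇ-partition xs)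
  ... | false = trans (+-suc _ _) (cong suc (length-filterᵇ-partition xs))

  product-map-if : ∀ m n xs →
    product (map (λ x → if p x then m else n) xs) ≡ m ^ length (filterᵇ p xs) * n ^ length (filterᵇ (not ∘ p) xs)
  product-map-if m n []       = refl
  product-map-if m n (x ∷ xs) with p x
  ... | true  = trans (cong (m *_) (product-map-if m n xs)) (≡.sym (*-assoc m _ _))
  ... | false = trans (cong (n *_) (product-map-if m n xs)) (x∙yz≈y∙xz n (m ^ length (filterᵇ p xs)) _)

-- Arithmetic

4mn≤[m+n]² : ∀ m n → 4 * (m * n) ≤ (m + n) * (m + n)
4mn≤[m+n]² m n = [ ordered , (λ n≤m → ≡.subst₂ _≤_ (cong (4 *_) (*-comm n m)) (cong₂ _*_ (+-comm n m) (+-comm n m))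
                                                   (ordered n≤m)) ]′ (≤-total m n)
  where
  ordered : ∀ {m n} → m ≤ n → 4 * (m * n) ≤ (m + n) * (m + n)
  ordered {m} m≤n with m≤n⇒∃[o]m+o≡n m≤n
  ... | k , refl = ≡.subst₂ _≤_
    (solve 2 (λ m k → con 4 :* (m :* m) :+ con 4 :* (m :* k) := con 4 :* (m :* (m :+ k))) refl m k)
    (solve 2 (λ m k → con 4 :* (m :* m) :+ con 4 :* (m :* k) :+ k :* k := (m :+ (m :+ k)) :* (m :+ (m :+ k))) refl m k)
    (m≤m+n (4 * (m * m) + 4 * (m * k)) (k * k))

-- 4 d (m − 1) ≤ (d + m − 1)² ≤ (t − 1)(d + m − 1), rearranged so that no subtraction occurs.
vertex-bound : ∀ t d m → d + m ≤ t → 1 ≤ m → 4 * (d * m) + t + d + m ≤ t * (d + m) + 4 * d + 1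
vertex-bound zero    d (suc n) d+m≤0 _ with () ← ≤-trans (m≤n+m (suc n) d) d+m≤0
vertex-bound (suc T) d (suc n) d+m≤t _ = ≡.subst₂ _≤_
  (solve 3 (λ T d n → (con 5 :* d :+ n :+ con 2 :+ T) :+ con 4 :* (d :* n)
                    := con 4 :* (d :* (con 1 :+ n)) :+ (con 1 :+ T) :+ d :+ (con 1 :+ n)) refl T d n)
  (solve 3 (λ T d n → (con 5 :* d :+ n :+ con 2 :+ T) :+ T :* (d :+ n)
                    := (con 1 :+ T) :* (d :+ (con 1 :+ n)) :+ con 4 :* d :+ con 1) refl T d n)
  (+-monoʳ-≤ (5 * d + n + 2 + T) (≤-trans (4mn≤[m+n]² d n) (*-monoˡ-≤ (d + n) d+n≤T)))
  where
  d+n≤T : d + n ≤ T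
  d+n≤T = ≤-pred (≡.subst (_≤ suc T) (+-suc d n) d+m≤t)

-- Adds twice the first hypothesis to the second; at t = 3 + s what remains is (t − 3) e ≤ (t − 1) E.
double-counting-arith : ∀ s e E P → 2 * e * (3 + s) ≤ 2 * P →
  4 * P + (3 + s) * (3 + s) + 2 * e + (2 * E + (3 + s))
    ≤ (3 + s) * (2 * e + (2 * E + (3 + s))) + 4 * (2 * e) + (3 + s) →
  s * e ≤ (2 + s) * E
double-counting-arith s e E P h₁ h₂ =
  *-cancelˡ-≤ 2 (+-cancelˡ-≤ X _ _ (≡.subst₂ _≤_ lhs rhs (≤-trans (+-monoˡ-≤ _ (+-monoˡ-≤ _ (+-monoˡ-≤ _ h))) h₂)))
  where
  X = (3 + s) * (3 + s) + (3 + s) + 14 * e + 2 * (s * e) + 2 * E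
  h : 2 * (2 * e * (3 + s)) ≤ 4 * P
  h = ≤-trans (*-monoʳ-≤ 2 h₁) (≤-reflexive (≡.sym (*-assoc 2 2 P)))
  lhs : 2 * (2 * e * (3 + s)) + (3 + s) * (3 + s) + 2 * e + (2 * E + (3 + s)) ≡ X + 2 * (s * e)
  lhs = solve 3 (λ s e E → con 2 :* (con 2 :* e :* (con 3 :+ s)) :+ (con 3 :+ s) :* (con 3 :+ s) :+ con 2 :* e
                           :+ (con 2 :* E :+ (con 3 :+ s))
                         := (con 3 :+ s) :* (con 3 :+ s) :+ (con 3 :+ s) :+ con 14 :* e :+ con 2 :* (s :* e)
                           :+ con 2 :* E :+ con 2 :* (s :* e)) refl s e E
  rhs : (3 + s) * (2 * e + (2 * E + (3 + s))) + 4 * (2 * e) + (3 + s) ≡ X + 2 * ((2 + s) * E)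
  rhs = solve 3 (λ s e E → (con 3 :+ s) :* (con 2 :* e :+ (con 2 :* E :+ (con 3 :+ s))) :+ con 4 :* (con 2 :* e)
                           :+ (con 3 :+ s)
                         := (con 3 :+ s) :* (con 3 :+ s) :+ (con 3 :+ s) :+ con 14 :* e :+ con 2 :* (s :* e)
                           :+ con 2 :* E :+ con 2 :* ((con 2 :+ s) :* E)) refl s e E

^-distribʳ-* : ∀ m n k → (m * n) ^ k ≡ m ^ k * n ^ k
^-distribʳ-* m n zero    = refl
^-distribʳ-* m n (suc k) = trans (cong (m * n *_) (^-distribʳ-* m n k)) ([m*n]*[o*p]≡[m*o]*[n*p] m n (m ^ k) (n ^ k))

3^25≤2^40 : 3 ^ 25 ≤ 2 ^ 40
3^25≤2^40 = toWitness {a? = 3 ^ 25 ≤? 2 ^ 40} _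

sparse-bound : ∀ a b c → 5 * b ≤ 7 * c → (2 ^ a * 3 ^ b) ^ 25 * 2 ^ (4 * c) ≤ 2 ^ (25 * (a + b + c))
sparse-bound a b c 5b≤7c = begin
  (2 ^ a * 3 ^ b) ^ 25 * 2 ^ (4 * c)
    ≡⟨ cong (_* 2 ^ (4 * c)) (trans (^-distribʳ-* (2 ^ a) (3 ^ b) 25)
                                     (cong₂ _*_ (^-*-assoc 2 a 25) (trans (^-*-assoc 3 b 25) (cong (3 ^_) (*-comm b 25))))) ⟩
  2 ^ (a * 25) * 3 ^ (25 * b) * 2 ^ (4 * c)
    ≡⟨ cong (λ x → 2 ^ (a * 25) * x * 2 ^ (4 * c)) (^-*-assoc 3 25 b) ⟨
  2 ^ (a * 25) * (3 ^ 25) ^ b * 2 ^ (4 * c)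
    ≤⟨ *-monoˡ-≤ (2 ^ (4 * c)) (*-monoʳ-≤ (2 ^ (a * 25)) (^-monoˡ-≤ b 3^25≤2^40)) ⟩
  2 ^ (a * 25) * (2 ^ 40) ^ b * 2 ^ (4 * c)
    ≡⟨ cong (λ x → 2 ^ (a * 25) * x * 2 ^ (4 * c)) (^-*-assoc 2 40 b) ⟩
  2 ^ (a * 25) * 2 ^ (40 * b) * 2 ^ (4 * c)
    ≡⟨ trans (cong (_* 2 ^ (4 * c)) (≡.sym (^-distribˡ-+-* 2 (a * 25) (40 * b))))
             (≡.sym (^-distribˡ-+-* 2 (a * 25 + 40 * b) (4 * c))) ⟩
  2 ^ (a * 25 + 40 * b + 4 * c)
    ≤⟨ ^-monoʳ-≤ 2 exponent-bound ⟩
  2 ^ (25 * (a + b + c))  ∎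
  where
  open ≤-Reasoning
  exponent-bound : a * 25 + 40 * b + 4 * c ≤ 25 * (a + b + c)
  exponent-bound = ≡.subst₂ _≤_
    (solve 3 (λ a b c → a :* con 25 :+ con 25 :* b :+ con 4 :* c :+ con 3 :* (con 5 :* b)
                      := a :* con 25 :+ con 40 :* b :+ con 4 :* c) refl a b c)
    (solve 3 (λ a b c → a :* con 25 :+ con 25 :* b :+ con 4 :* c :+ con 3 :* (con 7 :* c)
                      := con 25 :* (a :+ b :+ c)) refl a b c)
    (+-monoʳ-≤ (a * 25 + 25 * b + 4 * c) (*-monoʳ-≤ 3 5b≤7c))

2*nC2+n≡n*n : ∀ n → 2 * (n C 2) + n ≡ n * n
2*nC2+n≡n*n zero    = refl
2*nC2+n≡n*n (suc n) = begin
  2 * (suc n C 2) + suc n        ≡⟨ cong (λ x → 2 * x + suc n) (nCk+nC[k+1]≡[n+1]C[k+1] n 1) ⟨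
  2 * (n C 1 + n C 2) + suc n    ≡⟨ cong (λ x → 2 * (x + n C 2) + suc n) (nC1≡n n) ⟩
  2 * (n + n C 2) + suc n        ≡⟨ solve 2 (λ n c → con 2 :* (n :+ c) :+ (con 1 :+ n) := (con 2 :* c :+ n) :+ con 1 :+ con 2 :* n) refl n (n C 2) ⟩
  2 * (n C 2) + n + 1 + 2 * n    ≡⟨ cong (λ x → x + 1 + 2 * n) (2*nC2+n≡n*n n) ⟩
  n * n + 1 + 2 * n              ≡⟨ solve 1 (λ n → n :* n :+ con 1 :+ con 2 :* n := (con 1 :+ n) :* (con 1 :+ n)) refl n ⟩
  suc n * suc n                  ∎
  where open ≡-Reasoning

dense-bound : ∀ t a b c → a + b + c ≡ t C 2 → t * t < 4 * c → (2 ^ a * 3 ^ b) ^ 4 < 3 ^ (t * t)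
dense-bound t a b c a+b+c≡tC2 t²<4c = begin-strict
  (2 ^ a * 3 ^ b) ^ 4      ≤⟨ ^-monoˡ-≤ 4 (*-monoˡ-≤ (3 ^ b) (^-monoˡ-≤ a (s≤s (s≤s z≤n)))) ⟩
  (3 ^ a * 3 ^ b) ^ 4      ≡⟨ cong (_^ 4) (^-distribˡ-+-* 3 a b) ⟨
  (3 ^ (a + b)) ^ 4        ≡⟨ ^-*-assoc 3 (a + b) 4 ⟩
  3 ^ ((a + b) * 4)        <⟨ ^-monoʳ-< 3 (s≤s (s≤s z≤n)) exponent-bound ⟩
  3 ^ (t * t)              ∎
  where
  open ≤-Reasoning
  exponent-bound : (a + b) * 4 < t * t
  exponent-bound = +-cancelʳ-< (t * t) ((a + b) * 4) (t * t) (begin-strict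
    (a + b) * 4 + t * t      <⟨ +-monoʳ-< ((a + b) * 4) t²<4c ⟩
    (a + b) * 4 + 4 * c      ≡⟨ solve 3 (λ a b c → (a :+ b) :* con 4 :+ con 4 :* c := con 2 :* (con 2 :* (a :+ b :+ c))) refl a b c ⟩
    2 * (2 * (a + b + c))    ≡⟨ cong (λ x → 2 * (2 * x)) a+b+c≡tC2 ⟩
    2 * (2 * (t C 2))        ≤⟨ *-monoʳ-≤ 2 (≤-trans (m≤m+n _ t) (≤-reflexive (2*nC2+n≡n*n t))) ⟩
    2 * (t * t)              ≡⟨ cong (t * t +_) (+-identityʳ (t * t)) ⟩
    t * t + t * t            ∎)

-- Weight-3 edges

module _ {t} (G : Graph t) where

  weight3 : Fin t → Fin t → Bool
  weight3 i j = adj G i j ∧ not (inTriangle G (i , j))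

  deg₃ : Fin t → ℕ
  deg₃ u = ∑[ k < t ] 𝟙 (weight3 u k)

  -- counts u itself, adj being irreflexive
  nonDeg : Fin t → ℕ
  nonDeg u = ∑[ k < t ] 𝟙 (not (adj G u k))

  e₂+e₃+ē≡tC2 : e₂ G + e₃ G + ē G ≡ t C 2
  e₂+e₃+ē≡tC2 = begin
    e₂ G + e₃ G + ē G         ≡⟨ cong (_+ ē G) (length-filterᵇ-partition (inTriangle G) (edges G)) ⟩
    length (edges G) + ē G    ≡⟨ length-filterᵇ-partition (λ e → adj G (proj₁ e) (proj₂ e)) (pairs t) ⟩
    length (pairs t)          ≡⟨ length-pairs t ⟩
    t C 2                     ∎
    where open ≡-Reasoning

  e₃≡∑∑ : e₃ G ≡ ∑[ i < t ] ∑[ j < t ] ([ i < j ] * 𝟙 (weight3 i j))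
  e₃≡∑∑ = begin
    e₃ G
      ≡⟨ length-filter (T? ∘ not ∘ inTriangle G) (edges G) ⟩
    List.sum (map (𝟙 ∘ not ∘ inTriangle G) (edges G))
      ≡⟨ sum-map-filter (λ e → T? (adj G (proj₁ e) (proj₂ e))) (𝟙 ∘ not ∘ inTriangle G) (pairs t) ⟩
    List.sum (map (λ e → 𝟙 (adj G (proj₁ e) (proj₂ e)) * 𝟙 (not (inTriangle G e))) (pairs t))
      ≡⟨ sum-map-pairs {t} _ ⟩
    ∑[ i < t ] ∑[ j < t ] ([ i < j ] * (𝟙 (adj G i j) * 𝟙 (not (inTriangle G (i , j)))))
      ≡⟨ sum-cong-≗ {t} (λ i → sum-cong-≗ {t} (λ j →
           cong ([ i < j ] *_) (𝟙-∧ (adj G i j) (not (inTriangle G (i , j)))))) ⟨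
    ∑[ i < t ] ∑[ j < t ] ([ i < j ] * 𝟙 (weight3 i j))  ∎
    where open ≡-Reasoning

  ē≡∑∑ : ē G ≡ ∑[ i < t ] ∑[ j < t ] ([ i < j ] * 𝟙 (not (adj G i j)))
  ē≡∑∑ = trans (length-filter (λ e → T? (not (adj G (proj₁ e) (proj₂ e)))) (pairs t)) (sum-map-pairs {t} _)

  inTriangle-sym : ∀ i j → inTriangle G (i , j) ≡ inTriangle G (j , i)
  inTriangle-sym i j = cong or (map-cong (λ k → ∧-comm (adj G i k) (adj G j k)) (allFin t))

  weight3-sym : ∀ i j → weight3 i j ≡ weight3 j i
  weight3-sym i j = cong₂ (λ a b → a ∧ not b) (sym G i j) (inTriangle-sym i j)

  ∑-deg₃ : ∑[ u < t ] deg₃ u ≡ 2 * e₃ G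
  ∑-deg₃ = begin
    ∑[ u < t ] deg₃ u
      ≡⟨ ∑∑-symmetric (λ i j → 𝟙 (weight3 i j)) (λ i j → cong 𝟙 (weight3-sym i j)) ⟩
    2 * ∑[ i < t ] ∑[ j < t ] ([ i < j ] * 𝟙 (weight3 i j)) + ∑[ u < t ] 𝟙 (weight3 u u)
      ≡⟨ cong₂ _+_ (cong (2 *_) (≡.sym e₃≡∑∑)) (sum-cong-≗ {t} (λ u → cong (λ a → 𝟙 (a ∧ not (inTriangle G (u , u)))) (irrefl G u))) ⟩
    2 * e₃ G + ∑[ u < t ] 0
      ≡⟨ cong (2 * e₃ G +_) (trans (∑-const t 0) (*-zeroʳ t)) ⟩
    2 * e₃ G + 0
      ≡⟨ +-identityʳ _ ⟩
    2 * e₃ G  ∎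
    where open ≡-Reasoning

  ∑-nonDeg : ∑[ u < t ] nonDeg u ≡ 2 * ē G + t
  ∑-nonDeg = begin
    ∑[ u < t ] nonDeg u
      ≡⟨ ∑∑-symmetric (λ i j → 𝟙 (not (adj G i j))) (λ i j → cong (𝟙 ∘ not) (sym G i j)) ⟩
    2 * ∑[ i < t ] ∑[ j < t ] ([ i < j ] * 𝟙 (not (adj G i j))) + ∑[ u < t ] 𝟙 (not (adj G u u))
      ≡⟨ cong₂ _+_ (cong (2 *_) (≡.sym ē≡∑∑)) (sum-cong-≗ {t} (λ u → cong (𝟙 ∘ not) (irrefl G u))) ⟩
    2 * ē G + ∑[ u < t ] 1
      ≡⟨ cong (2 * ē G +_) (trans (∑-const t 1) (*-identityʳ t)) ⟩
    2 * ē G + t  ∎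
    where open ≡-Reasoning

  common-neighbour⇒inTriangle : ∀ i j k → T (adj G i k ∧ adj G j k) → T (inTriangle G (i , j))
  common-neighbour⇒inTriangle i j k h = any⁺ (λ k → adj G i k ∧ adj G j k) (lose (∈-allFin k) h)

  no-triangle⇒t≤nonDeg+nonDeg : ∀ i j → ¬ T (inTriangle G (i , j)) → t ≤ nonDeg i + nonDeg j
  no-triangle⇒t≤nonDeg+nonDeg i j ¬tri = begin
    t                                                        ≡⟨ trans (∑-const t 1) (*-identityʳ t) ⟨
    ∑[ k < t ] 1                                             ≤⟨ ∑-mono-≤ non-neighbour-of-one ⟩
    ∑[ k < t ] (𝟙 (not (adj G i k)) + 𝟙 (not (adj G j k)))   ≡⟨ ∑-distrib-+ (𝟙 ∘ not ∘ adj G i) (𝟙 ∘ not ∘ adj G j) ⟩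
    nonDeg i + nonDeg j                                      ∎
    where
    open ≤-Reasoning
    non-neighbour-of-one : ∀ k → 1 ≤ 𝟙 (not (adj G i k)) + 𝟙 (not (adj G j k))
    non-neighbour-of-one k with adj G i k | adj G j k | common-neighbour⇒inTriangle i j k
    ... | true  | true  | tri = ⊥-elim (¬tri (tri _))
    ... | true  | false | _   = ≤-refl
    ... | false | _     | _   = s≤s z≤n

  weight3-nonDeg-bound : ∀ i j → 𝟙 (weight3 i j) * t ≤ 𝟙 (weight3 i j) * (nonDeg i + nonDeg j)
  weight3-nonDeg-bound i j with adj G i j | inTriangle G (i , j) | no-triangle⇒t≤nonDeg+nonDeg i j
  ... | true  | false | t≤ = +-monoˡ-≤ 0 (t≤ λ ())
  ... | true  | true  | _  = z≤n
  ... | false | _     | _  = z≤n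

  deg₃+nonDeg≤t : ∀ u → deg₃ u + nonDeg u ≤ t
  deg₃+nonDeg≤t u = begin
    deg₃ u + nonDeg u                                        ≡⟨ ∑-distrib-+ (𝟙 ∘ weight3 u) (𝟙 ∘ not ∘ adj G u) ⟨
    ∑[ k < t ] (𝟙 (weight3 u k) + 𝟙 (not (adj G u k)))       ≤⟨ ∑-mono-≤ (λ k → edge-or-non-edge (adj G u k) _) ⟩
    ∑[ k < t ] 1                                             ≡⟨ trans (∑-const t 1) (*-identityʳ t) ⟩
    t                                                        ∎
    where
    open ≤-Reasoning
    edge-or-non-edge : ∀ a b → 𝟙 (a ∧ b) + 𝟙 (not a) ≤ 1
    edge-or-non-edge true  true  = ≤-refl
    edge-or-non-edge true  false = z≤n
    edge-or-non-edge false b     = ≤-refl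

  1≤nonDeg : ∀ u → 1 ≤ nonDeg u
  1≤nonDeg u = ≡.subst (λ a → 𝟙 (not a) ≤ nonDeg u) (irrefl G u) (term≤∑ (𝟙 ∘ not ∘ adj G u) u)

  ∑deg₃*t≤2∑deg₃*nonDeg : (∑[ u < t ] deg₃ u) * t ≤ 2 * ∑[ u < t ] (deg₃ u * nonDeg u)
  ∑deg₃*t≤2∑deg₃*nonDeg = begin
    (∑[ u < t ] deg₃ u) * t
      ≡⟨ trans (*-distribʳ-sum t deg₃) (sum-cong-≗ {t} (λ i → *-distribʳ-sum t (F i))) ⟩
    ∑[ i < t ] ∑[ j < t ] (F i j * t)
      ≤⟨ ∑-mono-≤ (λ i → ∑-mono-≤ (weight3-nonDeg-bound i)) ⟩
    ∑[ i < t ] ∑[ j < t ] (F i j * (nonDeg i + nonDeg j))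
      ≡⟨ sum-cong-≗ {t} (λ i → trans (sum-cong-≗ {t} (λ j → *-distribˡ-+ (F i j) (nonDeg i) (nonDeg j)))
                                      (∑-distrib-+ (λ j → F i j * nonDeg i) (λ j → F i j * nonDeg j))) ⟩
    ∑[ i < t ] (∑[ j < t ] (F i j * nonDeg i) + ∑[ j < t ] (F i j * nonDeg j))
      ≡⟨ ∑-distrib-+ (λ i → ∑[ j < t ] (F i j * nonDeg i)) (λ i → ∑[ j < t ] (F i j * nonDeg j)) ⟩
    ∑[ i < t ] ∑[ j < t ] (F i j * nonDeg i) + ∑[ i < t ] ∑[ j < t ] (F i j * nonDeg j)
      ≡⟨ cong (Q +_) (trans (∑-comm (λ i j → F i j * nonDeg j))
                            (sum-cong-≗ {t} (λ j → sum-cong-≗ {t} (λ i → cong (λ b → 𝟙 b * nonDeg j) (weight3-sym i j))))) ⟩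
    Q + Q
      ≡⟨ cong₂ _+_ row-sums (trans row-sums (≡.sym (+-identityʳ _))) ⟩
    2 * ∑[ u < t ] (deg₃ u * nonDeg u)  ∎
    where
    open ≤-Reasoning
    F : Fin t → Fin t → ℕ
    F i j = 𝟙 (weight3 i j)
    Q = ∑[ i < t ] ∑[ j < t ] (F i j * nonDeg i)
    row-sums : Q ≡ ∑[ u < t ] (deg₃ u * nonDeg u)
    row-sums = sum-cong-≗ {t} (λ i → ≡.sym (*-distribʳ-sum (nonDeg i) (F i)))

  ∑-vertex-bound :
    4 * ∑[ u < t ] (deg₃ u * nonDeg u) + t * t + ∑[ u < t ] deg₃ u + ∑[ u < t ] nonDeg u
      ≤ t * (∑[ u < t ] deg₃ u + ∑[ u < t ] nonDeg u) + 4 * ∑[ u < t ] deg₃ u + t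
  ∑-vertex-bound = begin
    4 * P + t * t + D + M
      ≡⟨ cong (λ x → x + D + M) (cong₂ _+_ (*-distribˡ-sum 4 (λ u → deg₃ u * nonDeg u)) (≡.sym (∑-const t t))) ⟩
    ∑[ u < t ] (4 * (deg₃ u * nonDeg u)) + ∑[ u < t ] t + D + M
      ≡⟨ trans (∑-distrib-+ {t} _ nonDeg) (cong (_+ M) (trans (∑-distrib-+ {t} _ deg₃) (cong (_+ D) (∑-distrib-+ {t} _ (λ _ → t))))) ⟨
    ∑[ u < t ] (4 * (deg₃ u * nonDeg u) + t + deg₃ u + nonDeg u)
      ≤⟨ ∑-mono-≤ (λ u → vertex-bound t (deg₃ u) (nonDeg u) (deg₃+nonDeg≤t u) (1≤nonDeg u)) ⟩
    ∑[ u < t ] (t * (deg₃ u + nonDeg u) + 4 * deg₃ u + 1)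
      ≡⟨ trans (∑-distrib-+ {t} _ (λ _ → 1)) (cong₂ _+_ (∑-distrib-+ {t} _ (λ u → 4 * deg₃ u)) (∑-const t 1)) ⟩
    ∑[ u < t ] (t * (deg₃ u + nonDeg u)) + ∑[ u < t ] (4 * deg₃ u) + t * 1
      ≡⟨ cong₂ _+_ (cong₂ _+_
           (trans (≡.sym (*-distribˡ-sum t (λ u → deg₃ u + nonDeg u))) (cong (t *_) (∑-distrib-+ deg₃ nonDeg)))
           (≡.sym (*-distribˡ-sum 4 deg₃))) (*-identityʳ t) ⟩
    t * (D + M) + 4 * D + t  ∎
    where
    open ≤-Reasoning
    P = ∑[ u < t ] (deg₃ u * nonDeg u)
    D = ∑[ u < t ] deg₃ u
    M = ∑[ u < t ] nonDeg u

s*e₃≤[2+s]*ē : ∀ s (G : Graph (3 + s)) → s * e₃ G ≤ (2 + s) * ē G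
s*e₃≤[2+s]*ē s G = double-counting-arith s (e₃ G) (ē G) P
  (≡.subst (λ D → D * (3 + s) ≤ 2 * P) (∑-deg₃ G) (∑deg₃*t≤2∑deg₃*nonDeg G))
  (≡.subst₂ (λ D M → 4 * P + (3 + s) * (3 + s) + D + M ≤ (3 + s) * (D + M) + 4 * D + (3 + s))
            (∑-deg₃ G) (∑-nonDeg G) (∑-vertex-bound G))
  where
  P = ∑[ u < 3 + s ] (deg₃ G u * nonDeg G u)

5*e₃≤7*ē : ∀ {t} (G : Graph t) → 8 ≤ t → 5 * e₃ G ≤ 7 * ē G
5*e₃≤7*ē G 8≤t with m≤n⇒∃[o]m+o≡n 8≤t
... | o , refl = *-cancelˡ-≤ (5 + o) (begin
  (5 + o) * (5 * e₃ G)      ≡⟨ solve 2 (λ o e → (con 5 :+ o) :* (con 5 :* e) := con 5 :* ((con 5 :+ o) :* e)) refl o (e₃ G) ⟩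
  5 * ((5 + o) * e₃ G)      ≤⟨ *-monoʳ-≤ 5 (s*e₃≤[2+s]*ē (5 + o) G) ⟩
  5 * ((7 + o) * ē G)       ≤⟨ ≡.subst₂ _≤_ (solve 2 (λ o E → con 35 :* E :+ con 5 :* (o :* E) := con 5 :* ((con 7 :+ o) :* E)) refl o (ē G))
                                             (solve 2 (λ o E → con 35 :* E :+ con 5 :* (o :* E) :+ con 2 :* (o :* E)
                                                             := (con 5 :+ o) :* (con 7 :* E)) refl o (ē G))
                                             (m≤m+n _ _) ⟩
  (5 + o) * (7 * ē G)       ∎)
  where open ≤-Reasoning

lemma4p3 : (t : ℕ) → 1000 < t → (G : Graph t) →
    (4 * ē G ≤ t * t →
       (w G ≡ 2 ^ e₂ G * 3 ^ e₃ G)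
       × (w G ^ 25 * 2 ^ (4 * ē G) ≤ 2 ^ (25 * (t C 2))))
    × (t * t < 4 * ē G → w G ^ 4 < 3 ^ (t * t))
lemma4p3 t 1000<t G = (λ _ → w≡2^e₂*3^e₃ , sparse) , dense
  where
  w≡2^e₂*3^e₃ : w G ≡ 2 ^ e₂ G * 3 ^ e₃ G
  w≡2^e₂*3^e₃ = product-map-if (inTriangle G) 2 3 (edges G)

  sparse : w G ^ 25 * 2 ^ (4 * ē G) ≤ 2 ^ (25 * (t C 2))
  sparse = ≡.subst₂ (λ x n → x ^ 25 * 2 ^ (4 * ē G) ≤ 2 ^ (25 * n)) (≡.sym w≡2^e₂*3^e₃) (e₂+e₃+ē≡tC2 G)
             (sparse-bound (e₂ G) (e₃ G) (ē G) (5*e₃≤7*ē G (≤-trans (m≤m+n 8 993) 1000<t)))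

  dense : t * t < 4 * ē G → w G ^ 4 < 3 ^ (t * t)
  dense = ≡.subst (λ x → t * t < 4 * ē G → x ^ 4 < 3 ^ (t * t)) (≡.sym w≡2^e₂*3^e₃)
            (dense-bound t (e₂ G) (e₃ G) (ē G) (e₂+e₃+ē≡tC2 G))
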